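{- Let $M$ be a finite ordinal monoid with merge. For every $A\subseteq M$, $$\mathrm{Cl}^{+}(A)=A\cdot\mathrm{Cl}^{*}(A)=\mathrm{Cl}^{*}(A)\cdot A\qquad\text{and}\qquad\mathrm{Cl}^{\mathrm{ord}+}(A)=A\cdot\mathrm{Cl}^{\mathrm{ord}}(A),$$ where products of subsets are elementwise.
   Context: A finite ordinal monoid with merge is a finite ordered ordinal monoid, given by its unit $1$, order $\leqslant$, binary product $\cdot$ and $\omega$-power $-^\omega$ (with $\pi$ monotone), together with a monotone map $-^{\mathrm{merge}}:M\to M$ such that for all $a,b\in M$ and integers $k$: $a^{\mathrm{idem}+k}\leqslant a^{\mathrm{merge}}$, $(a^{\mathrm{idem}})^{\mathrm{merge}}=a^{\mathrm{idem}}$, $a^{\mathrm{merge}}\cdot a^{\mathrm{merge}}=(a^{\mathrm{merge}})^{\mathrm{merge}}=a^{\mathrm{merge}}$, $(a\cdot b)^{\mathrm{merge}}=a\cdot(b\cdot a)^{\mathrm{merge}}\cdot b$ (here $a^{\mathrm{idem}+k}$ is the eventual value of $a^{n!+k}$, $a^{\mathrm{idem}}$ the idempotent power). For $A\subseteq M$: $\mathrm{Cl}^{+}(A)$ is the closure of $A$ under $\cdot$ and $-^{\mathrm{merge}}$; $\mathrm{Cl}^{*}(A)=\mathrm{Cl}^{+}(A)\cup\{1\}$; $\mathrm{Cl}^{\mathrm{ord}+}(A)$ is the closure of $A$ under $\cdot$, $-^{\mathrm{merge}}$ and $-^\omega$; $\mathrm{Cl}^{\mathrm{ord}}(A)$ is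 the least set containing $A$ and $1$ closed under $\cdot$, $-^{\mathrm{merge}}$, $-^\omega$. -}

module Defs where

open import Data.Nat using (ℕ; zero; suc; _≥_)
open import Data.Nat using (_!)
open import Data.Integer as ℤ using (ℤ; +_)
open import Data.Fin using (Fin)
open import Data.Product using (Σ; ∃; ∃-syntax; _×_; _,_)
open import Data.Sum using (_⊎_)
open import Function.Bundles using (_↔_)
open import Relation.Binary.PropositionalEquality using (_≡_)
open import Relation.Binary.Structures using (IsPartialOrder)
open import Relation.Unary using (Pred)
open import Level using (0ℓ)

powℕ : {C : Set} → (C → C → C) → C → C → ℕ → C
powℕ _∙_ e a zero    = e
powℕ _∙_ e a (suc n) = a ∙ powℕ _∙_ e a n

-- x is the eventual value of a^(n! + k) (i.e. x = a^(idem+k));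
-- with k = 0 this says x = a^idem.
EventualPow : {C : Set} → (C → C → C) → C → C → ℤ → C → Set
EventualPow _∙_ e a k x =
  ∃[ n₀ ] ∀ n → n ≥ n₀ → ∀ (m : ℕ) → + m ≡ (+ (n !)) ℤ.+ k → powℕ _∙_ e a m ≡ x

record FiniteOrdinalMonoidWithMerge : Set₁ where
  infixl 7 _·_
  field
    Carrier : Set
    size    : ℕ
    enum    : Carrier ↔ Fin size
    𝟙       : Carrier
    _·_     : Carrier → Carrier → Carrier
    _≤_     : Carrier → Carrier → Set
    ω       : Carrier → Carrier
    merge   : Carrier → Carrier
    ≤-isPartialOrder : IsPartialOrder _≡_ _≤_
    ·-assoc  : ∀ a b c → (a · b) · c ≡ a · (b · c)
    ·-identityˡ : ∀ a → 𝟙 · a ≡ a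
    ·-identityʳ : ∀ a → a · 𝟙 ≡ a
    ω-shift  : ∀ a b → ω (a · b) ≡ a · ω (b · a)
    ω-pow    : ∀ a n → ω (powℕ _·_ 𝟙 a (suc n)) ≡ ω a
    ω-unit   : ω 𝟙 ≡ 𝟙
    ·-mono   : ∀ {a a′ b b′} → a ≤ a′ → b ≤ b′ → (a · b) ≤ (a′ · b′)
    ω-mono   : ∀ {a a′} → a ≤ a′ → ω a ≤ ω a′
    merge-mono   : ∀ {a a′} → a ≤ a′ → merge a ≤ merge a′
    merge-idem+k : ∀ a (k : ℤ) x → EventualPow _·_ 𝟙 a k x → x ≤ merge a
    merge-idem   : ∀ a e → EventualPow _·_ 𝟙 a (+ 0) e → merge e ≡ e
    merge-·      : ∀ a → merge a · merge a ≡ merge a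
    merge-merge  : ∀ a → merge (merge a) ≡ merge a
    merge-shift  : ∀ a b → merge (a · b) ≡ a · merge (b · a) · b

module _ (M : FiniteOrdinalMonoidWithMerge) where
  open FiniteOrdinalMonoidWithMerge M

  _⊙_ : Pred Carrier 0ℓ → Pred Carrier 0ℓ → Pred Carrier 0ℓ
  (A ⊙ B) x = ∃[ a ] ∃[ b ] (A a × B b × x ≡ a · b)

  data Cl⁺ (A : Pred Carrier 0ℓ) : Pred Carrier 0ℓ where
    inc  : ∀ {a} → A a → Cl⁺ A a
    mul  : ∀ {a b} → Cl⁺ A a → Cl⁺ A b → Cl⁺ A (a · b)
    mrg  : ∀ {a} → Cl⁺ A a → Cl⁺ A (merge a)

  Cl* : Pred Carrier 0ℓ → Pred Carrier 0ℓ
  Cl* A x = Cl⁺ A x ⊎ x ≡ 𝟙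

  data Clord⁺ (A : Pred Carrier 0ℓ) : Pred Carrier 0ℓ where
    inc  : ∀ {a} → A a → Clord⁺ A a
    mul  : ∀ {a b} → Clord⁺ A a → Clord⁺ A b → Clord⁺ A (a · b)
    mrg  : ∀ {a} → Clord⁺ A a → Clord⁺ A (merge a)
    omg  : ∀ {a} → Clord⁺ A a → Clord⁺ A (ω a)

  data Clord (A : Pred Carrier 0ℓ) : Pred Carrier 0ℓ where
    inc  : ∀ {a} → A a → Clord A a
    one  : Clord A 𝟙
    mul  : ∀ {a b} → Clord A a → Clord A b → Clord A (a · b)
    mrg  : ∀ {a} → Clord A a → Clord A (merge a)
    omg  : ∀ {a} → Clord A a → Clord A (ω a)

{-# OPTIONS --safe #-}
-- The shift laws merge (a · c) = a · merge (c · a) · c and ω (a · c) = a · ω (c · a)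
-- keep a leading letter a ∈ A in front, so every element generated from A factors as
-- a · c with a ∈ A (and symmetrically for merge, as c · a).  Conversely adjoining 𝟙
-- to the closure adds nothing new after a letter, and 𝟙 stays 𝟙 under merge
-- (it is its own idempotent power) and under ω.
module Submission where

open import Defs
open import Data.Product using (_×_; _,_)
open import Data.Sum using (_⊎_; inj₁; inj₂)
open import Data.Nat using (zero; suc)
open import Relation.Unary using (Pred; _⊆_; _≐_)
open import Relation.Binary.PropositionalEquality using (_≡_; refl; sym; trans; subst; cong)
open import Level using (0ℓ)
open FiniteOrdinalMonoidWithMerge using (Carrier)

module _ (M : FiniteOrdinalMonoidWithMerge) where
  open FiniteOrdinalMonoidWithMerge M hiding (Carrier)

  pow-𝟙 : ∀ m → powℕ _·_ 𝟙 𝟙 m ≡ 𝟙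
  pow-𝟙 zero    = refl
  pow-𝟙 (suc m) = trans (cong (𝟙 ·_) (pow-𝟙 m)) (·-identityˡ 𝟙)

  merge-𝟙 : merge 𝟙 ≡ 𝟙
  merge-𝟙 = merge-idem 𝟙 𝟙 (0 , λ _ _ m _ → pow-𝟙 m)

  module _ {A S : Pred (Carrier M) 0ℓ} where

    A⊙S-·ʳ : (∀ {x y} → S x → S y → S (x · y)) →
             ∀ {x y} → _⊙_ M A S x → S y → _⊙_ M A S (x · y)
    A⊙S-·ʳ S-· {y = y} (a , c , a∈A , c∈S , refl) y∈S =
      a , c · y , a∈A , S-· c∈S y∈S , ·-assoc a c y

    S⊙A-·ˡ : (∀ {x y} → S x → S y → S (x · y)) →
             ∀ {x y} → S x → _⊙_ M S A y → _⊙_ M S A (x · y)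
    S⊙A-·ˡ S-· x∈S (c , a , c∈S , a∈A , refl) =
      _ · c , a , S-· x∈S c∈S , a∈A , sym (·-assoc _ c a)

    A⊙S-merge : A ⊆ S → (∀ {x y} → S x → S y → S (x · y)) → (∀ {x} → S x → S (merge x)) →
                ∀ {x} → _⊙_ M A S x → _⊙_ M A S (merge x)
    A⊙S-merge A⊆S S-· S-merge (a , c , a∈A , c∈S , refl) =
      a , merge (c · a) · c , a∈A , S-· (S-merge (S-· c∈S (A⊆S a∈A))) c∈S ,
      trans (merge-shift a c) (·-assoc a (merge (c · a)) c)

    S⊙A-merge : A ⊆ S → (∀ {x y} → S x → S y → S (x · y)) → (∀ {x} → S x → S (merge x)) →
                ∀ {x} → _⊙_ M S A x → _⊙_ M S A (merge x)
    S⊙A-merge A⊆S S-· S-merge (c , a , c∈S , a∈A , refl) =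
      c · merge (a · c) , a , S-· c∈S (S-merge (S-· (A⊆S a∈A) c∈S)) , a∈A , merge-shift c a

    A⊙S-ω : A ⊆ S → (∀ {x y} → S x → S y → S (x · y)) → (∀ {x} → S x → S (ω x)) →
            ∀ {x} → _⊙_ M A S x → _⊙_ M A S (ω x)
    A⊙S-ω A⊆S S-· S-ω (a , c , a∈A , c∈S , refl) =
      a , ω (c · a) , a∈A , S-ω (S-· c∈S (A⊆S a∈A)) , ω-shift a c

  module _ {A : Pred (Carrier M) 0ℓ} where

    Cl⁺-·-Cl* : ∀ {x y} → Cl⁺ M A x → Cl* M A y → Cl⁺ M A (x · y)
    Cl⁺-·-Cl* p (inj₁ q)    = mul p q
    Cl⁺-·-Cl* p (inj₂ refl) = subst (Cl⁺ M A) (sym (·-identityʳ _)) p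

    Cl*-·-Cl⁺ : ∀ {x y} → Cl* M A x → Cl⁺ M A y → Cl⁺ M A (x · y)
    Cl*-·-Cl⁺ (inj₁ p)    q = mul p q
    Cl*-·-Cl⁺ (inj₂ refl) q = subst (Cl⁺ M A) (sym (·-identityˡ _)) q

    Cl*-· : ∀ {x y} → Cl* M A x → Cl* M A y → Cl* M A (x · y)
    Cl*-· (inj₁ p)    q = inj₁ (Cl⁺-·-Cl* p q)
    Cl*-· (inj₂ refl) q = subst (Cl* M A) (sym (·-identityˡ _)) q

    Cl*-merge : ∀ {x} → Cl* M A x → Cl* M A (merge x)
    Cl*-merge (inj₁ p)    = inj₁ (mrg p)
    Cl*-merge (inj₂ refl) = inj₂ merge-𝟙

    A⊆Cl* : A ⊆ Cl* M A
    A⊆Cl* a∈A = inj₁ (inc a∈A)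

    Cl⁺⊆A⊙Cl* : Cl⁺ M A ⊆ _⊙_ M A (Cl* M A)
    Cl⁺⊆A⊙Cl* (inc {a} a∈A) = a , 𝟙 , a∈A , inj₂ refl , sym (·-identityʳ a)
    Cl⁺⊆A⊙Cl* (mul p q)     = A⊙S-·ʳ Cl*-· (Cl⁺⊆A⊙Cl* p) (inj₁ q)
    Cl⁺⊆A⊙Cl* (mrg p)       = A⊙S-merge A⊆Cl* Cl*-· Cl*-merge (Cl⁺⊆A⊙Cl* p)

    Cl⁺⊆Cl*⊙A : Cl⁺ M A ⊆ _⊙_ M (Cl* M A) A
    Cl⁺⊆Cl*⊙A (inc {a} a∈A) = 𝟙 , a , inj₂ refl , a∈A , sym (·-identityˡ a)
    Cl⁺⊆Cl*⊙A (mul p q)     = S⊙A-·ˡ Cl*-· (inj₁ p) (Cl⁺⊆Cl*⊙A q)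
    Cl⁺⊆Cl*⊙A (mrg p)       = S⊙A-merge A⊆Cl* Cl*-· Cl*-merge (Cl⁺⊆Cl*⊙A p)

    A⊙Cl*⊆Cl⁺ : _⊙_ M A (Cl* M A) ⊆ Cl⁺ M A
    A⊙Cl*⊆Cl⁺ (_ , _ , a∈A , c∈Cl* , refl) = Cl⁺-·-Cl* (inc a∈A) c∈Cl*

    Cl*⊙A⊆Cl⁺ : _⊙_ M (Cl* M A) A ⊆ Cl⁺ M A
    Cl*⊙A⊆Cl⁺ (_ , _ , c∈Cl* , a∈A , refl) = Cl*-·-Cl⁺ c∈Cl* (inc a∈A)

    Clord⁺⊆Clord : Clord⁺ M A ⊆ Clord M A
    Clord⁺⊆Clord (inc a∈A) = inc a∈A
    Clord⁺⊆Clord (mul p q) = mul (Clord⁺⊆Clord p) (Clord⁺⊆Clord q)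
    Clord⁺⊆Clord (mrg p)   = mrg (Clord⁺⊆Clord p)
    Clord⁺⊆Clord (omg p)   = omg (Clord⁺⊆Clord p)

    Clord⊆Clord⁺∪𝟙 : ∀ {x} → Clord M A x → Clord⁺ M A x ⊎ x ≡ 𝟙
    Clord⊆Clord⁺∪𝟙 (inc a∈A) = inj₁ (inc a∈A)
    Clord⊆Clord⁺∪𝟙 one       = inj₂ refl
    Clord⊆Clord⁺∪𝟙 (mul p q) with Clord⊆Clord⁺∪𝟙 p | Clord⊆Clord⁺∪𝟙 q
    ... | inj₁ p⁺   | inj₁ q⁺   = inj₁ (mul p⁺ q⁺)
    ... | inj₁ p⁺   | inj₂ refl = inj₁ (subst (Clord⁺ M A) (sym (·-identityʳ _)) p⁺)
    ... | inj₂ refl | inj₁ q⁺   = inj₁ (subst (Clord⁺ M A) (sym (·-identityˡ _)) q⁺)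
    ... | inj₂ refl | inj₂ refl = inj₂ (·-identityˡ 𝟙)
    Clord⊆Clord⁺∪𝟙 (mrg p) with Clord⊆Clord⁺∪𝟙 p
    ... | inj₁ p⁺   = inj₁ (mrg p⁺)
    ... | inj₂ refl = inj₂ merge-𝟙
    Clord⊆Clord⁺∪𝟙 (omg p) with Clord⊆Clord⁺∪𝟙 p
    ... | inj₁ p⁺   = inj₁ (omg p⁺)
    ... | inj₂ refl = inj₂ ω-unit

    Clord⁺⊆A⊙Clord : Clord⁺ M A ⊆ _⊙_ M A (Clord M A)
    Clord⁺⊆A⊙Clord (inc {a} a∈A) = a , 𝟙 , a∈A , one , sym (·-identityʳ a)
    Clord⁺⊆A⊙Clord (mul p q)     = A⊙S-·ʳ mul (Clord⁺⊆A⊙Clord p) (Clord⁺⊆Clord q)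
    Clord⁺⊆A⊙Clord (mrg p)       = A⊙S-merge inc mul mrg (Clord⁺⊆A⊙Clord p)
    Clord⁺⊆A⊙Clord (omg p)       = A⊙S-ω inc mul omg (Clord⁺⊆A⊙Clord p)

    A⊙Clord⊆Clord⁺ : _⊙_ M A (Clord M A) ⊆ Clord⁺ M A
    A⊙Clord⊆Clord⁺ (a , _ , a∈A , c∈Clord , refl) with Clord⊆Clord⁺∪𝟙 c∈Clord
    ... | inj₁ c∈Clord⁺ = mul (inc a∈A) c∈Clord⁺
    ... | inj₂ refl     = subst (Clord⁺ M A) (sym (·-identityʳ a)) (inc a∈A)

mainTheorem10 : (M : FiniteOrdinalMonoidWithMerge) (A : Pred (Carrier M) 0ℓ) →
    ((Cl⁺ M A ≐ _⊙_ M A (Cl* M A)) × (Cl⁺ M A ≐ _⊙_ M (Cl* M A) A))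
      × (Clord⁺ M A ≐ _⊙_ M A (Clord M A))
mainTheorem10 M A =
  ((Cl⁺⊆A⊙Cl* M , A⊙Cl*⊆Cl⁺ M) , (Cl⁺⊆Cl*⊙A M , Cl*⊙A⊆Cl⁺ M)) ,
  (Clord⁺⊆A⊙Clord M , A⊙Clord⊆Clord⁺ M)
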